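{- Let $k\geq1$ and let $\sigma$ be a permutation of $\{1,\ldots,k\}$ with $\sigma\neq\mathrm{Id}$. Then $\|\boldsymbol{s}_0^{\sigma}\|>\|\boldsymbol{s}_0\|$.
   Context: $q\geq 2$ is a prime power. $\boldsymbol{s}_0=(s_{0,1},\ldots,s_{0,k})\in\mathbb{N}^k$ with $s_{0,l}=\sum_{i=0}^{k-1-l}q^{2i}$, i.e. $\boldsymbol{s}_0=(1+q^2+\cdots+q^{2(k-2)},\ldots,1+q^2,1,0)$. For $\boldsymbol{s}=(s_1,\ldots,s_k)\in\mathbb{N}^k$, $\|\boldsymbol{s}\|=\sum_{i=1}^ks_iq^{i-1}$, and for a permutation $\sigma$ of $\{1,\ldots,k\}$, $\boldsymbol{s}^{\sigma}=(s_{\sigma(1)},\ldots,s_{\sigma(k)})$. -}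

module Defs where

open import Data.Nat using (ℕ; zero; suc; _+_; _*_; _∸_; _^_)
open import Data.Nat.Primality using (Prime)
open import Data.Fin using (Fin; toℕ; zero; suc)
open import Data.Fin.Permutation using (Permutation′; _⟨$⟩ʳ_)
open import Data.Product using (Σ; _×_)
open import Relation.Binary.PropositionalEquality using (_≡_)

sumBelow : ℕ → (ℕ → ℕ) → ℕ
sumBelow zero    f = 0
sumBelow (suc n) f = sumBelow n f + f n

IsPrimePower : ℕ → Set
IsPrimePower q = Σ ℕ λ p → Σ ℕ λ m → Prime p × (q ≡ p ^ suc m)

-- vectors in ℕ^k as functions Fin k → ℕ; index i : Fin k stands for l = toℕ i + 1
-- s₀ at l : Σ_{j=0}^{k-1-l} q^(2j), i.e. sum over j < k - l = k ∸ (toℕ i + 1)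
s₀ : (q k : ℕ) → Fin k → ℕ
s₀ q k i = sumBelow (k ∸ suc (toℕ i)) (λ j → q ^ (2 * j))

-- ‖s‖ = Σ_{l=1}^k s_l q^(l-1)  (index i : Fin k corresponds to l = toℕ i + 1)
norm : (q : ℕ) → {k : ℕ} → (Fin k → ℕ) → ℕ
norm q {zero}  s = 0
norm q {suc k} s = s zero + q * norm q (λ i → s (suc i))

permute : {k : ℕ} → Permutation′ k → (Fin k → ℕ) → (Fin k → ℕ)
permute σ s i = s (σ ⟨$⟩ʳ i)

{-# OPTIONS --safe #-}
-- A strictly decreasing vector s is the unique minimiser of ‖s^σ‖ over all
-- permutations σ when q ≥ 2.  By induction on k: ‖s^σ‖ is s_{σ(1)} plus q times
-- the norm of a rearrangement of s with the entry s_{σ(1)} removed.  If that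
-- entry is not the largest one, exchanging it with the largest entry s_1 strictly
-- lowers the norm, since x + q y < y + q x whenever y < x.
module Submission where

open import Defs
open import Data.Nat using (ℕ; NonZero; >-nonZero; _<_; _≥_; zero; suc; _+_; _*_; _^_; _≤_; z≤n; s≤s)
open import Data.Nat.Properties
open import Data.Nat.Primality using (prime⇒nonZero; prime⇒nonTrivial)
open import Data.Nat.Base using (nonTrivial⇒n>1)
open import Data.Nat.Tactic.RingSolver using (solve-∀)
open import Data.Fin using (Fin; punchIn) renaming (zero to fz; suc to fs; _<_ to _<ᶠ_)
open import Data.Fin.Properties using (toℕ<n)
open import Data.Fin.Permutation using (Permutation′; _⟨$⟩ʳ_; remove; punchIn-permute)
open import Data.Product using (_,_)
open import Data.Sum using (inj₁; inj₂)
open import Function using (_∘_)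
open import Relation.Binary.PropositionalEquality using (_≡_; refl; sym; trans; cong; cong₂)
open import Relation.Nullary using (¬_; contradiction)

StrictlyDecreasing : {k : ℕ} → (Fin k → ℕ) → Set
StrictlyDecreasing s = ∀ {i j} → i <ᶠ j → s j < s i

punchIn-mono-< : ∀ {n} (i : Fin (suc n)) {j l : Fin n} → j <ᶠ l → punchIn i j <ᶠ punchIn i l
punchIn-mono-< fz     j<l                     = s≤s j<l
punchIn-mono-< (fs i) {fz}   {fs l} _         = s≤s z≤n
punchIn-mono-< (fs i) {fs j} {fs l} (s≤s j<l) = s≤s (punchIn-mono-< i j<l)

remove-fz-identity : ∀ {k} (σ : Permutation′ (suc k)) → σ ⟨$⟩ʳ fz ≡ fz →
  (∀ i → remove fz σ ⟨$⟩ʳ i ≡ i) → ∀ i → σ ⟨$⟩ʳ i ≡ i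
remove-fz-identity σ σ0≡0 τ-id fz     = σ0≡0
remove-fz-identity σ σ0≡0 τ-id (fs i) = trans (punchIn-permute σ fz i)
  (cong₂ punchIn σ0≡0 (τ-id i))

exchange-< : ∀ {q x y} (C : ℕ) → 2 ≤ q → y < x → x + q * (y + C) < y + q * (x + C)
exchange-< {suc zero} C (s≤s ()) _
exchange-< {suc (suc r)} {x} {y} C _ y<x = begin-strict
  x + (2 + r) * (y + C)               ≡⟨ regroup r x y C ⟩
  (x + y + (2 + r) * C) + (y + r * y) <⟨ +-monoʳ-< (x + y + (2 + r) * C)
                                           (+-mono-<-≤ y<x (*-monoʳ-≤ r (<⇒≤ y<x))) ⟩
  (x + y + (2 + r) * C) + (x + r * x) ≡⟨ sym (regroup′ r x y C) ⟩
  y + (2 + r) * (x + C)               ∎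
  where
  open ≤-Reasoning
  regroup : ∀ r x y C → x + (2 + r) * (y + C) ≡ (x + y + (2 + r) * C) + (y + r * y)
  regroup = solve-∀
  regroup′ : ∀ r x y C → y + (2 + r) * (x + C) ≡ (x + y + (2 + r) * C) + (x + r * x)
  regroup′ = solve-∀

module Rearrangement {q : ℕ} (q≥2 : 2 ≤ q) where

  instance
    q≢0 : NonZero q
    q≢0 = >-nonZero (<-trans (s≤s z≤n) q≥2)

  norm-cong : ∀ {k} {f g : Fin k → ℕ} → (∀ i → f i ≡ g i) → norm q f ≡ norm q g
  norm-cong {zero}  f≗g = refl
  norm-cong {suc k} f≗g = cong₂ (λ a b → a + q * b) (f≗g fz) (norm-cong (f≗g ∘ fs))

  headCost : ∀ {k} → (Fin (suc k) → ℕ) → Fin (suc k) → ℕ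
  headCost s j = s j + q * norm q (s ∘ punchIn j)

  headCost-fz-< : ∀ {k} {s : Fin (suc k) → ℕ} → StrictlyDecreasing s →
    (j : Fin k) → headCost s fz < headCost s (fs j)
  headCost-fz-≤ : ∀ {k} {s : Fin (suc k) → ℕ} → StrictlyDecreasing s →
    (j : Fin (suc k)) → headCost s fz ≤ headCost s j

  headCost-fz-< {suc k} {s} dec j = begin-strict
    s fz + q * norm q (s ∘ fs)
      ≤⟨ +-monoʳ-≤ (s fz) (*-monoʳ-≤ q (headCost-fz-≤ (dec ∘ s≤s) j)) ⟩
    s fz + q * (s (fs j) + q * norm q (s ∘ fs ∘ punchIn j))
      <⟨ exchange-< (q * norm q (s ∘ fs ∘ punchIn j)) q≥2 (dec (s≤s z≤n)) ⟩
    headCost s (fs j) ∎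
    where open ≤-Reasoning

  headCost-fz-≤ dec fz     = ≤-refl
  headCost-fz-≤ dec (fs j) = <⇒≤ (headCost-fz-< dec j)

  norm-permute-decompose : ∀ {k} (σ : Permutation′ (suc k)) (s : Fin (suc k) → ℕ) {j} →
    σ ⟨$⟩ʳ fz ≡ j →
    norm q (permute σ s) ≡ s j + q * norm q (permute (remove fz σ) (s ∘ punchIn j))
  norm-permute-decompose σ s refl =
    cong (λ n → s (σ ⟨$⟩ʳ fz) + q * n) (norm-cong (cong s ∘ punchIn-permute σ fz))

  norm-≤-norm-permute : ∀ {k} {s : Fin k → ℕ} → StrictlyDecreasing s →
    (σ : Permutation′ k) → norm q s ≤ norm q (permute σ s)
  norm-≤-norm-permute {zero} dec σ = ≤-refl
  norm-≤-norm-permute {suc k} {s} dec σ = begin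
    norm q s                                     ≤⟨ headCost-fz-≤ dec j ⟩
    s j + q * norm q (s ∘ punchIn j)             ≤⟨ +-monoʳ-≤ (s j) (*-monoʳ-≤ q
                                                     (norm-≤-norm-permute (dec ∘ punchIn-mono-< j) τ)) ⟩
    s j + q * norm q (permute τ (s ∘ punchIn j)) ≡⟨ sym (norm-permute-decompose σ s refl) ⟩
    norm q (permute σ s)                         ∎
    where
    open ≤-Reasoning
    j = σ ⟨$⟩ʳ fz
    τ = remove fz σ

  norm-<-norm-permute : ∀ {k} {s : Fin k → ℕ} → StrictlyDecreasing s →
    (σ : Permutation′ k) → ¬ (∀ i → σ ⟨$⟩ʳ i ≡ i) → norm q s < norm q (permute σ s)
  norm-<-norm-permute {zero} dec σ σ≢id = contradiction (λ ()) σ≢id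
  norm-<-norm-permute {suc k} {s} dec σ σ≢id = viaHead (σ ⟨$⟩ʳ fz) refl
    where
    open ≤-Reasoning
    τ = remove fz σ
    viaHead : ∀ j → σ ⟨$⟩ʳ fz ≡ j → norm q s < norm q (permute σ s)
    viaHead (fs j) σ0≡j = begin-strict
      norm q s                                               <⟨ headCost-fz-< dec j ⟩
      headCost s (fs j)                                      ≤⟨ +-monoʳ-≤ (s (fs j)) (*-monoʳ-≤ q
                                                                 (norm-≤-norm-permute (dec ∘ punchIn-mono-< (fs j)) τ)) ⟩
      s (fs j) + q * norm q (permute τ (s ∘ punchIn (fs j))) ≡⟨ sym (norm-permute-decompose σ s σ0≡j) ⟩
      norm q (permute σ s)                                   ∎
    viaHead fz σ0≡0 = begin-strict
      norm q s                               <⟨ +-monoʳ-< (s fz) (*-monoʳ-< q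
                                                 (norm-<-norm-permute (dec ∘ s≤s) τ τ≢id)) ⟩
      s fz + q * norm q (permute τ (s ∘ fs)) ≡⟨ sym (norm-permute-decompose σ s σ0≡0) ⟩
      norm q (permute σ s)                   ∎
      where
      τ≢id : ¬ (∀ i → τ ⟨$⟩ʳ i ≡ i)
      τ≢id = σ≢id ∘ remove-fz-identity σ σ0≡0

sumBelow-< : ∀ {f : ℕ → ℕ} → (∀ j → 0 < f j) → ∀ {m n} → m < n → sumBelow m f < sumBelow n f
sumBelow-< {f} f>0 {m} {suc n} m<1+n with m<1+n⇒m<n∨m≡n m<1+n
... | inj₁ m<n  = <-trans (sumBelow-< f>0 m<n) (m<m+n (sumBelow n f) (f>0 n))
... | inj₂ refl = m<m+n (sumBelow n f) (f>0 n)

s₀-strictlyDecreasing : ∀ {q} .{{_ : NonZero q}} k → StrictlyDecreasing (s₀ q k)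
s₀-strictlyDecreasing {q} k {j = j} i<j =
  sumBelow-< (λ e → m^n>0 q (2 * e)) (∸-monoʳ-< (s≤s i<j) (toℕ<n j))

primePower-≥2 : ∀ {q} → IsPrimePower q → 2 ≤ q
primePower-≥2 (p , m , p-prime , refl) = ≤-trans (nonTrivial⇒n>1 p) (m≤m*n p (p ^ m))
  where
  instance
    _ = prime⇒nonTrivial p-prime
    _ = prime⇒nonZero p-prime
    _ = m^n≢0 p m

mainTheorem11 : (q : ℕ) → IsPrimePower q → (k : ℕ) → k ≥ 1 →
    (σ : Permutation′ k) → ¬ (∀ (i : Fin k) → σ ⟨$⟩ʳ i ≡ i) →
    norm q (s₀ q k) < norm q (permute σ (s₀ q k))
mainTheorem11 q q-primePower k _ σ σ≢id =
  norm-<-norm-permute (s₀-strictlyDecreasing k) σ σ≢id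
  where open Rearrangement (primePower-≥2 q-primePower)
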